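{- Let $k$ be a positive integer and consider the $\mathcal{L}\mathcal{R}$-ending partisan subtraction game with subtraction set $S = \{2, 4k+3\}$. Let $G$ be the position consisting of a single pile of $n \ge 0$ tokens. Then the equivalence class of $G$ is periodic in $n$ with period $4k+5$, and for $0 \le n < 4k+5$ it is given by: for $\ell = 0, \dots, k-1$, $G \equiv *L$ if $n = 4\ell$, $G \equiv *R$ if $n = 4\ell+1$, $G \equiv \{*L\}$ if $n = 4\ell+2$, $G \equiv \{*R\}$ if $n = 4\ell+3$; moreover $G \equiv *L$ if $n = 4k$, $G \equiv *R$ if $n = 4k+1$, $G \equiv \{*L\}$ if $n = 4k+2$, $G \equiv \{*L, *R\}$ if $n = 4k+3$, and $G \equiv \{*R, \{*L\}\}$ if $n = 4k+4$.
   Context: Abstract positions are defined recursively: $*L$ and $*R$ are terminal positions; if $G_1,\dots,G_m$ ($m\ge 1$) are positions, then $\{G_1,\dots,G_m\}$ is a position with options $G_1,\dots,G_m$. Play: Left and Right move alternately, each choosing any option of the current position; when a terminal position is reached, Left wins if it is $*L$ and Right wins if it is $*R$. Disjunctive sum: $*L + *L = *R + *R = *L$, $*L + *R = *R + *L = *R$; if at least one of $G,H$ is non-terminal, $G+H$ has options all $G'+H$ ($G'$ an option of $G$) and all $G+H'$ ($H'$ an option of $H$). Outcome classes: $\mathcal{L}$, $\mathcal{R}$, $\mathcal{N}$, $\mathcal{P}$ (Left wins, Right wins, first player wins, second player wins, respectively); $o(G)$ is the outcome class. Equivalence: $G \equiv H$ iff $o(G+X) = o(H+X)$ for every abstract position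 $X$. The $\mathcal{L}\mathcal{R}$-ending partisan subtraction game with subtraction set $S$: a move consists of choosing a pile and removing $s \in S$ tokens from it (requiring $s \le$ pile size); both players have the same moves; when no move is possible, Left wins if the total number of remaining tokens is even and Right wins if it is odd. A single pile of $n$ tokens is identified with an abstract position recursively: if no move is possible it is $*L$ for $n$ even and $*R$ for $n$ odd; otherwise it is $\{P_{n-s} : s \in S, s \le n\}$, where $P_m$ is the position of a single pile with $m$ tokens. -}

module Defs where

open import Data.Nat using (ℕ; zero; suc; _+_; _∸_; _<_; _≤_; _<?_; _≤?_)
open import Data.Nat.Properties using (∸-monoʳ-<)
open import Data.Nat.Induction using (<-rec)
open import Data.Fin using (Fin; splitAt)
open import Data.Sum using ([_,_]′)
open import Data.Bool using (Bool; true; false; not; _∨_)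
open import Data.List using (List; []; _∷_; length; lookup)
open import Relation.Nullary using (yes; no)
open import Relation.Binary.PropositionalEquality using (_≡_)

-- Abstract positions: terminal *L, *R, or {G_1,…,G_m} with m ≥ 1
-- (represented as m = suc m' options indexed by Fin (suc m')).
data Pos : Set where
  *L   : Pos
  *R   : Pos
  node : (m : ℕ) → (Fin (suc m) → Pos) → Pos

⟪_⟫ : Pos → Pos
⟪ G ⟫ = node 0 (λ _ → G)

⟪_,_⟫ : Pos → Pos → Pos
⟪ G , H ⟫ = node 1 (lookup (G ∷ H ∷ []))

infixl 6 _⊕_
_⊕_ : Pos → Pos → Pos
*L ⊕ *L = *L
*L ⊕ *R = *R
*R ⊕ *L = *R
*R ⊕ *R = *L
*L ⊕ node n g = node n (λ j → *L ⊕ g j)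
*R ⊕ node n g = node n (λ j → *R ⊕ g j)
node m f ⊕ *L = node m (λ i → f i ⊕ *L)
node m f ⊕ *R = node m (λ i → f i ⊕ *R)
node m f ⊕ node n g =
  node (m + suc n)
    (λ k → [ (λ i → f i ⊕ node n g) , (λ j → node m f ⊕ g j) ]′ (splitAt (suc m) k))

anyFin : (n : ℕ) → (Fin n → Bool) → Bool
anyFin zero    p = false
anyFin (suc n) p = p Fin.zero ∨ anyFin n (λ i → p (Fin.suc i))

-- leftFirst G : Left, moving first in G, has a winning strategy.
-- rightFirst G : Right, moving first in G, has a winning strategy.
mutual
  leftFirst : Pos → Bool
  leftFirst *L = true
  leftFirst *R = false
  leftFirst (node m f) = anyFin (suc m) (λ i → not (rightFirst (f i)))

  rightFirst : Pos → Bool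
  rightFirst *L = false
  rightFirst *R = true
  rightFirst (node m f) = anyFin (suc m) (λ i → not (leftFirst (f i)))

-- Outcome classes (there are no draws: the second player wins iff the
-- first player does not).
data Outcome : Set where
  𝓛 𝓡 𝓝 𝓟 : Outcome

outcomeOf : Bool → Bool → Outcome
outcomeOf true  false = 𝓛
outcomeOf false true  = 𝓡
outcomeOf true  true  = 𝓝
outcomeOf false false = 𝓟

o : Pos → Outcome
o G = outcomeOf (leftFirst G) (rightFirst G)

infix 4 _≡ᵍ_
_≡ᵍ_ : Pos → Pos → Set
G ≡ᵍ H = ∀ (X : Pos) → o (G ⊕ X) ≡ o (H ⊕ X)

isEven : ℕ → Bool
isEven zero    = true
isEven (suc n) = not (isEven n)

mkPos : ℕ → List Pos → Pos
mkPos n [] with isEven n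
... | true  = *L
... | false = *R
mkPos n (x ∷ xs) = node (length xs) (lookup (x ∷ xs))

-- Options of a pile of n tokens: P_{n-s} for s ∈ S with s ≤ n
-- (elements s = 0 are ignored; S below consists of positive integers).
options : (S : List ℕ) (n : ℕ) → (∀ m → m < n → Pos) → List Pos
options [] n rec = []
options (s ∷ S) n rec with 0 <? s | s ≤? n
... | yes 0<s | yes s≤n = rec (n ∸ s) (∸-monoʳ-< 0<s s≤n) ∷ options S n rec
... | _       | _       = options S n rec

pile : (S : List ℕ) → ℕ → Pos
pile S = <-rec (λ _ → Pos) (λ n rec → mkPos n (options S n (λ m p → rec {m} p)))

S₄ : ℕ → List ℕ
S₄ k = 2 ∷ (4 Data.Nat.* k + 3) ∷ []

module Submission where

-- Two positions are equivalent as soon as every winning first move in G ⊕ X can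
-- be answered by a winning move in H ⊕ X and vice versa.  Hence {·} and {·,·}
-- are congruences, a position all of whose options have a terminal T as an
-- option equals T, and {G, K} ≡ {G} when {G} is an option of K.
-- For S = {2, c} with c = 4k+3, a pile of n < c tokens has at most the option
-- n−2, so the piles below c run through *L, *R, {*L}, {*R} with period 4; from c
-- on the options are n−2 and n−c, which shift along with n.  Periodicity
-- therefore only has to be checked for n < c, where by induction it reduces to
-- {P(m), P(m+4)} ≡ {P(m)} and to a few identities between explicit positions
-- at the end of the window.

open import Defs
open import Data.Nat using (ℕ; zero; suc; _+_; _*_; _∸_; _<_; _≤_; _<?_; _≤?_; z≤n; s≤s)
open import Data.Nat.Properties
open import Data.Nat.Induction using (<-wellFounded; <-rec)
open import Data.Nat.Tactic.RingSolver using (solve-∀)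
open import Algebra.Properties.CommutativeSemigroup +-commutativeSemigroup using (xy∙z≈xz∙y)
open import Induction.WellFounded using (module FixPoint)
open import Data.Fin using (Fin; splitAt; _↑ˡ_; _↑ʳ_) renaming (zero to fzero; suc to fsuc)
open import Data.Fin.Properties using (splitAt-↑ˡ; splitAt-↑ʳ)
open import Data.Bool using (Bool; true; false; not; _∨_)
open import Data.Bool.Properties using (⇔→≡; not-injective)
open import Data.Sum using (_⊎_; inj₁; inj₂; [_,_]′)
-- _,_ is renamed because it would make ⟪ G , H ⟫ ambiguous.
open import Data.Product using (_×_; ∃-syntax) renaming (_,_ to _,,_)
open import Data.List using (List; []; _∷_; lookup)
open import Data.Empty using (⊥-elim)
open import Function.Bundles using (mk⇔)
open import Relation.Nullary using (¬_; yes; no; contradiction)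
open import Relation.Binary.Bundles using (Setoid)
open import Relation.Binary.PropositionalEquality
import Relation.Binary.Reasoning.Setoid as SetoidReasoning

data Player : Set where
  left right : Player

opponent : Player → Player
opponent left  = right
opponent right = left

firstWins : Player → Pos → Bool
firstWins left  = leftFirst
firstWins right = rightFirst

firstWins-node : ∀ s m f →
  firstWins s (node m f) ≡ anyFin (suc m) (λ i → not (firstWins (opponent s) (f i)))
firstWins-node left  m f = refl
firstWins-node right m f = refl

Wins Loses : Player → Pos → Set
Wins  s G = firstWins s G ≡ true
Loses s G = firstWins s G ≡ false

data Terminal : Pos → Set where
  *L-terminal : Terminal *L
  *R-terminal : Terminal *R

infix 4 _∈ₒ_
data _∈ₒ_ : Pos → Pos → Set where
  option : ∀ {m f} (i : Fin (suc m)) → f i ∈ₒ node m f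

terminal-has-no-option : ∀ {T T'} → Terminal T → ¬ (T' ∈ₒ T)
terminal-has-no-option *L-terminal ()
terminal-has-no-option *R-terminal ()

anyFin-intro : ∀ n (p : Fin n → Bool) i → p i ≡ true → anyFin n p ≡ true
anyFin-intro (suc n) p fzero    pi = cong (_∨ anyFin n (λ j → p (fsuc j))) pi
anyFin-intro (suc n) p (fsuc i) pi with p fzero
... | true  = refl
... | false = anyFin-intro n (λ j → p (fsuc j)) i pi

anyFin-witness : ∀ n (p : Fin n → Bool) → anyFin n p ≡ true → ∃[ i ] p i ≡ true
anyFin-witness (suc n) p any with p fzero in p0
... | true  = fzero ,, p0
... | false with anyFin-witness n (λ j → p (fsuc j)) any
...   | i ,, pi = fsuc i ,, pi

wins-by-move : ∀ s {G G'} → G' ∈ₒ G → Loses (opponent s) G' → Wins s G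
wins-by-move s (option {m} {f} i) loses =
  trans (firstWins-node s m f)
    (anyFin-intro (suc m) (λ i → not (firstWins (opponent s) (f i))) i (cong not loses))

winning-move : ∀ s G → Wins s G → Terminal G ⊎ ∃[ G' ] G' ∈ₒ G × Loses (opponent s) G'
winning-move s *L _ = inj₁ *L-terminal
winning-move s *R _ = inj₁ *R-terminal
winning-move s (node m f) wins
  with i ,, pi ← anyFin-witness (suc m) (λ i → not (firstWins (opponent s) (f i)))
                   (trans (sym (firstWins-node s m f)) wins)
  = inj₂ (f i ,, option i ,, not-injective pi)

opponent-involutive : ∀ s → opponent (opponent s) ≡ s
opponent-involutive left  = refl
opponent-involutive right = refl

wins-after-move : ∀ s {G G'} → Loses (opponent s) G → G' ∈ₒ G → Wins s G'
wins-after-move s {G} {G'} loses G'∈G with firstWins s G' in w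
... | true  = refl
... | false with () ← trans (sym loses)
  (wins-by-move (opponent s) G'∈G (trans (cong (λ s → firstWins s G') (opponent-involutive s)) w))

⊕-optionˡ : ∀ {G G' X} → G' ∈ₒ G → G' ⊕ X ∈ₒ G ⊕ X
⊕-optionˡ {X = *L} (option i) = option i
⊕-optionˡ {X = *R} (option i) = option i
⊕-optionˡ {X = node n g} (option {m} {f} i) =
  subst (_∈ₒ node m f ⊕ node n g)
    (cong [ (λ i → f i ⊕ node n g) , (λ j → node m f ⊕ g j) ]′ (splitAt-↑ˡ (suc m) i (suc n)))
    (option (i ↑ˡ suc n))

⊕-optionʳ : ∀ {G X X'} → X' ∈ₒ X → G ⊕ X' ∈ₒ G ⊕ X
⊕-optionʳ {G = *L} (option j) = option j
⊕-optionʳ {G = *R} (option j) = option j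
⊕-optionʳ {G = node m f} (option {n} {g} j) =
  subst (_∈ₒ node m f ⊕ node n g)
    (cong [ (λ i → f i ⊕ node n g) , (λ j → node m f ⊕ g j) ]′ (splitAt-↑ʳ (suc m) (suc n) j))
    (option (suc m ↑ʳ j))

⊕-option-cases : ∀ {G X Y} → Y ∈ₒ G ⊕ X →
  (∃[ G' ] G' ∈ₒ G × Y ≡ G' ⊕ X) ⊎ (∃[ X' ] X' ∈ₒ X × Y ≡ G ⊕ X')
⊕-option-cases {*L} {node n g} (option j) = inj₂ (g j ,, option j ,, refl)
⊕-option-cases {*R} {node n g} (option j) = inj₂ (g j ,, option j ,, refl)
⊕-option-cases {node m f} {*L} (option i) = inj₁ (f i ,, option i ,, refl)
⊕-option-cases {node m f} {*R} (option i) = inj₁ (f i ,, option i ,, refl)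
⊕-option-cases {node m f} {node n g} (option k) with splitAt (suc m) k
... | inj₁ i = inj₁ (f i ,, option i ,, refl)
... | inj₂ j = inj₂ (g j ,, option j ,, refl)

⊕-terminal : ∀ {G X} → Terminal (G ⊕ X) → Terminal G × Terminal X
⊕-terminal {*L} {*L} _ = *L-terminal ,, *L-terminal
⊕-terminal {*L} {*R} _ = *L-terminal ,, *R-terminal
⊕-terminal {*R} {*L} _ = *R-terminal ,, *L-terminal
⊕-terminal {*R} {*R} _ = *R-terminal ,, *R-terminal
⊕-terminal {*L} {node _ _} ()
⊕-terminal {*R} {node _ _} ()
⊕-terminal {node _ _} {*L} ()
⊕-terminal {node _ _} {*R} ()
⊕-terminal {node _ _} {node _ _} ()

firstWinsᵒ : Player → Outcome → Bool
firstWinsᵒ left  𝓛 = true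
firstWinsᵒ left  𝓝 = true
firstWinsᵒ left  _ = false
firstWinsᵒ right 𝓡 = true
firstWinsᵒ right 𝓝 = true
firstWinsᵒ right _ = false

firstWins-outcome : ∀ s G → firstWins s G ≡ firstWinsᵒ s (o G)
firstWins-outcome left G with leftFirst G | rightFirst G
... | true  | true  = refl
... | true  | false = refl
... | false | true  = refl
... | false | false = refl
firstWins-outcome right G with leftFirst G | rightFirst G
... | true  | true  = refl
... | true  | false = refl
... | false | true  = refl
... | false | false = refl

firstWins-cong : ∀ s {G H} → o G ≡ o H → firstWins s G ≡ firstWins s H
firstWins-cong s {G} {H} oG≡oH = begin
  firstWins s G         ≡⟨ firstWins-outcome s G ⟩
  firstWinsᵒ s (o G)    ≡⟨ cong (firstWinsᵒ s) oG≡oH ⟩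
  firstWinsᵒ s (o H)    ≡⟨ firstWins-outcome s H ⟨
  firstWins s H         ∎
  where open ≡-Reasoning

≡ᵍ⇒firstWins : ∀ {G H} → G ≡ᵍ H → ∀ s X → firstWins s (G ⊕ X) ≡ firstWins s (H ⊕ X)
≡ᵍ⇒firstWins G≡H s X = firstWins-cong s (G≡H X)

module _ {G H : Pos}
  (answerˡ : ∀ s X {G'} → G' ∈ₒ G → Loses (opponent s) (G' ⊕ X) → Wins s (H ⊕ X))
  (answerʳ : ∀ s X {H'} → H' ∈ₒ H → Loses (opponent s) (H' ⊕ X) → Wins s (G ⊕ X))
  (terminal : ∀ {X} → Terminal G ⊎ Terminal H → Terminal X → o (G ⊕ X) ≡ o (H ⊕ X))
  where

  private
    mutual
      same-firstWins : ∀ X s → firstWins s (G ⊕ X) ≡ firstWins s (H ⊕ X)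
      same-firstWins X s = ⇔→≡ (mk⇔ (transferˡ X s) (transferʳ X s))

      transferˡ : ∀ X s → Wins s (G ⊕ X) → Wins s (H ⊕ X)
      transferˡ X s wins with winning-move s (G ⊕ X) wins
      ... | inj₁ term with G-term ,, X-term ← ⊕-terminal term =
        trans (sym (firstWins-cong s (terminal (inj₁ G-term) X-term))) wins
      ... | inj₂ (Y ,, Y∈G⊕X ,, loses) with ⊕-option-cases {G} {X} Y∈G⊕X
      ...   | inj₁ (G' ,, G'∈G ,, refl) = answerˡ s X G'∈G loses
      -- matching on option j (not on X' ∈ₒ X) exposes X' as a subterm of X,
      -- which makes the recursion through same-firstWins structural
      ...   | inj₂ (X' ,, option j ,, refl) =
        wins-by-move s (⊕-optionʳ {H} (option j)) (trans (sym (same-firstWins X' (opponent s))) loses)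

      transferʳ : ∀ X s → Wins s (H ⊕ X) → Wins s (G ⊕ X)
      transferʳ X s wins with winning-move s (H ⊕ X) wins
      ... | inj₁ term with H-term ,, X-term ← ⊕-terminal term =
        trans (firstWins-cong s (terminal (inj₂ H-term) X-term)) wins
      ... | inj₂ (Y ,, Y∈H⊕X ,, loses) with ⊕-option-cases {H} {X} Y∈H⊕X
      ...   | inj₁ (H' ,, H'∈H ,, refl) = answerʳ s X H'∈H loses
      ...   | inj₂ (X' ,, option j ,, refl) =
        wins-by-move s (⊕-optionʳ {G} (option j)) (trans (same-firstWins X' (opponent s)) loses)

  ≡ᵍ-by-answers : G ≡ᵍ H
  ≡ᵍ-by-answers X = cong₂ outcomeOf (same-firstWins X left) (same-firstWins X right)

≡ᵍ-refl : ∀ {G} → G ≡ᵍ G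
≡ᵍ-refl X = refl

≡ᵍ-sym : ∀ {G H} → G ≡ᵍ H → H ≡ᵍ G
≡ᵍ-sym G≡H X = sym (G≡H X)

≡ᵍ-trans : ∀ {G H K} → G ≡ᵍ H → H ≡ᵍ K → G ≡ᵍ K
≡ᵍ-trans G≡H H≡K X = trans (G≡H X) (H≡K X)

-- _≡ᵍ_ unfolds to a Π-type, so its implicit positions cannot be inferred and are
-- passed explicitly here and below.
≡ᵍ-setoid : Setoid _ _
≡ᵍ-setoid = record
  { Carrier = Pos
  ; _≈_ = _≡ᵍ_
  ; isEquivalence = record
      { refl  = λ {G} → ≡ᵍ-refl {G}
      ; sym   = λ {G H} → ≡ᵍ-sym {G} {H}
      ; trans = λ {G H K} → ≡ᵍ-trans {G} {H} {K}
      }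
  }

module ≡ᵍ-Reasoning = SetoidReasoning ≡ᵍ-setoid

≡⇒≡ᵍ : ∀ {G H} → G ≡ H → G ≡ᵍ H
≡⇒≡ᵍ refl X = refl

Loses-≡ᵍ : ∀ {G H} → G ≡ᵍ H → ∀ s X → Loses s (G ⊕ X) → Loses s (H ⊕ X)
Loses-≡ᵍ G≡H s X loses = trans (sym (≡ᵍ⇒firstWins G≡H s X)) loses

node-cong : ∀ {m f n g} →
  (∀ {G'} → G' ∈ₒ node m f → ∃[ H' ] H' ∈ₒ node n g × G' ≡ᵍ H') →
  (∀ {H'} → H' ∈ₒ node n g → ∃[ G' ] G' ∈ₒ node m f × H' ≡ᵍ G') →
  node m f ≡ᵍ node n g
node-cong matchˡ matchʳ = ≡ᵍ-by-answers answerˡ answerʳ (λ { (inj₁ ()) ; (inj₂ ()) })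
  where
  answerˡ : ∀ s X {G'} → G' ∈ₒ _ → Loses (opponent s) (G' ⊕ X) → Wins s (_ ⊕ X)
  answerˡ s X G'∈G loses with H' ,, H'∈H ,, G'≡H' ← matchˡ G'∈G =
    wins-by-move s (⊕-optionˡ H'∈H) (Loses-≡ᵍ G'≡H' (opponent s) X loses)
  answerʳ : ∀ s X {H'} → H' ∈ₒ _ → Loses (opponent s) (H' ⊕ X) → Wins s (_ ⊕ X)
  answerʳ s X H'∈H loses with G' ,, G'∈G ,, H'≡G' ← matchʳ H'∈H =
    wins-by-move s (⊕-optionˡ G'∈G) (Loses-≡ᵍ H'≡G' (opponent s) X loses)

singleton-≡ᵍ-⟪⟫ : ∀ G → node 0 (lookup (G ∷ [])) ≡ᵍ ⟪ G ⟫
singleton-≡ᵍ-⟪⟫ G = node-cong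
  (λ { (option fzero) → G ,, option fzero ,, ≡ᵍ-refl {G} ; (option (fsuc ())) })
  (λ { (option _) → G ,, option fzero ,, ≡ᵍ-refl {G} })

⟪⟫-cong : ∀ {G G'} → G ≡ᵍ G' → ⟪ G ⟫ ≡ᵍ ⟪ G' ⟫
⟪⟫-cong {G} {G'} G≡G' = node-cong
  (λ { (option _) → G' ,, option fzero ,, G≡G' })
  (λ { (option _) → G ,, option fzero ,, ≡ᵍ-sym {G} {G'} G≡G' })

⟪,⟫-cong : ∀ {G G' H H'} → G ≡ᵍ G' → H ≡ᵍ H' → ⟪ G , H ⟫ ≡ᵍ ⟪ G' , H' ⟫
⟪,⟫-cong {G} {G'} {H} {H'} G≡G' H≡H' = node-cong
  (λ { (option fzero) → G' ,, option fzero ,, G≡G'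
     ; (option (fsuc fzero)) → H' ,, option (fsuc fzero) ,, H≡H'
     ; (option (fsuc (fsuc ()))) })
  (λ { (option fzero) → G ,, option fzero ,, ≡ᵍ-sym {G} {G'} G≡G'
     ; (option (fsuc fzero)) → H ,, option (fsuc fzero) ,, ≡ᵍ-sym {H} {H'} H≡H'
     ; (option (fsuc (fsuc ()))) })

⟪,⟫-comm : ∀ G H → ⟪ G , H ⟫ ≡ᵍ ⟪ H , G ⟫
⟪,⟫-comm G H = node-cong
  (λ { (option fzero) → G ,, option (fsuc fzero) ,, ≡ᵍ-refl {G}
     ; (option (fsuc fzero)) → H ,, option fzero ,, ≡ᵍ-refl {H}
     ; (option (fsuc (fsuc ()))) })
  (λ { (option fzero) → H ,, option (fsuc fzero) ,, ≡ᵍ-refl {H}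
     ; (option (fsuc fzero)) → G ,, option fzero ,, ≡ᵍ-refl {G}
     ; (option (fsuc (fsuc ()))) })

⟪,⟫-absorb : ∀ {G H} → H ≡ᵍ G → ⟪ G , H ⟫ ≡ᵍ ⟪ G ⟫
⟪,⟫-absorb {G} {H} H≡G = node-cong
  (λ { (option fzero) → G ,, option fzero ,, ≡ᵍ-refl {G}
     ; (option (fsuc fzero)) → G ,, option fzero ,, H≡G
     ; (option (fsuc (fsuc ()))) })
  (λ { (option _) → G ,, option fzero ,, ≡ᵍ-refl {G} })

≡ᵍ-terminal-by-reversal : ∀ H {T} → Terminal T → (∀ {H'} → H' ∈ₒ H → T ∈ₒ H') →
  (∀ {X} → Terminal X → o (H ⊕ X) ≡ o (T ⊕ X)) → H ≡ᵍ T
≡ᵍ-terminal-by-reversal H {T} T-term reverses agree =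
  ≡ᵍ-by-answers answerˡ answerʳ (λ _ → agree)
  where
  answerˡ : ∀ s X {H'} → H' ∈ₒ H → Loses (opponent s) (H' ⊕ X) → Wins s (T ⊕ X)
  answerˡ s X H'∈H loses = wins-after-move s loses (⊕-optionˡ (reverses H'∈H))
  answerʳ : ∀ s X {T'} → T' ∈ₒ T → Loses (opponent s) (T' ⊕ X) → Wins s (H ⊕ X)
  answerʳ s X T'∈T = ⊥-elim (terminal-has-no-option T-term T'∈T)

⟪,⟫-reversible : ∀ {G K} → ⟪ G ⟫ ∈ₒ K → ⟪ G , K ⟫ ≡ᵍ ⟪ G ⟫
⟪,⟫-reversible {G} {K} reverses = ≡ᵍ-by-answers answerˡ answerʳ (λ { (inj₁ ()) ; (inj₂ ()) })
  where
  answerˡ : ∀ s X {H'} → H' ∈ₒ ⟪ G , K ⟫ → Loses (opponent s) (H' ⊕ X) → Wins s (⟪ G ⟫ ⊕ X)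
  answerˡ s X (option fzero) loses = wins-by-move s (⊕-optionˡ (option fzero)) loses
  answerˡ s X (option (fsuc fzero)) loses = wins-after-move s loses (⊕-optionˡ reverses)
  answerʳ : ∀ s X {G'} → G' ∈ₒ ⟪ G ⟫ → Loses (opponent s) (G' ⊕ X) → Wins s (⟪ G , K ⟫ ⊕ X)
  answerʳ s X (option _) loses = wins-by-move s (⊕-optionˡ (option fzero)) loses

options-cong : ∀ S n (rec rec' : ∀ m → m < n → Pos) → (∀ m m<n → rec m m<n ≡ rec' m m<n) →
  options S n rec ≡ options S n rec'
options-cong []      n rec rec' eq = refl
options-cong (s ∷ S) n rec rec' eq with 0 <? s | s ≤? n
... | yes _ | yes _ = cong₂ _∷_ (eq _ _) (options-cong S n rec rec' eq)
... | yes _ | no  _ = options-cong S n rec rec' eq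
... | no  _ | _     = options-cong S n rec rec' eq

pile-unfold : ∀ S n → pile S n ≡ mkPos n (options S n (λ m _ → pile S m))
pile-unfold S n = unfold-wfRec
  where
  open FixPoint <-wellFounded (λ _ → Pos) (λ n rec → mkPos n (options S n (λ m m<n → rec {m} m<n)))
    (λ n {rec} {rec'} eq → cong (mkPos n) (options-cong S n _ _ (λ m m<n → eq m<n)))

options-∷-≤ : ∀ s S n (G : ℕ → Pos) → 0 < s → s ≤ n →
  options (s ∷ S) n (λ m _ → G m) ≡ G (n ∸ s) ∷ options S n (λ m _ → G m)
options-∷-≤ s S n G 0<s s≤n with 0 <? s | s ≤? n
... | yes _   | yes _   = refl
... | no 0≮s  | _       = contradiction 0<s 0≮s
... | yes _   | no s≰n  = contradiction s≤n s≰n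

options-∷-≰ : ∀ s S n (G : ℕ → Pos) → ¬ s ≤ n →
  options (s ∷ S) n (λ m _ → G m) ≡ options S n (λ m _ → G m)
options-∷-≰ s S n G s≰n with 0 <? s | s ≤? n
... | yes _ | yes s≤n = contradiction s≤n s≰n
... | yes _ | no  _   = refl
... | no  _ | _       = refl

module TwoMoveGame (d c : ℕ) (0<d : 0 < d) (d≤c : d ≤ c) where

  Q : ℕ → Pos
  Q = pile (d ∷ c ∷ [])

  private
    0<c : 0 < c
    0<c = ≤-trans 0<d d≤c

    moves : ℕ → List Pos
    moves n = options (d ∷ c ∷ []) n (λ m _ → Q m)

    c≰ : ∀ {n} → n < c → ¬ c ≤ n
    c≰ n<c c≤n = <-irrefl refl (<-≤-trans n<c c≤n)

  pile-no-move : ∀ {n} → n < d → Q n ≡ mkPos n []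
  pile-no-move {n} n<d = trans (pile-unfold (d ∷ c ∷ []) n) (cong (mkPos n)
    (trans (options-∷-≰ d (c ∷ []) n Q (<⇒≱ n<d)) (options-∷-≰ c [] n Q (c≰ (<-≤-trans n<d d≤c)))))

  pile-one-move : ∀ m → d + m < c → Q (d + m) ≡ᵍ ⟪ Q m ⟫
  pile-one-move m d+m<c = begin
    Q (d + m)                     ≡⟨ pile-unfold (d ∷ c ∷ []) (d + m) ⟩
    mkPos (d + m) (moves (d + m))  ≡⟨ cong (mkPos (d + m)) one-move ⟩
    node 0 (lookup (Q m ∷ []))    ≈⟨ singleton-≡ᵍ-⟪⟫ (Q m) ⟩
    ⟪ Q m ⟫                       ∎
    where
    open ≡ᵍ-Reasoning
    one-move : moves (d + m) ≡ Q m ∷ []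
    one-move = trans (options-∷-≤ d (c ∷ []) (d + m) Q 0<d (m≤m+n d m))
      (cong₂ _∷_ (cong Q (m+n∸m≡n d m)) (options-∷-≰ c [] (d + m) Q (c≰ d+m<c)))

  pile-two-moves : ∀ m → Q (m + c) ≡ ⟪ Q (m + (c ∸ d)) , Q m ⟫
  pile-two-moves m = trans (pile-unfold (d ∷ c ∷ []) (m + c)) (cong (mkPos (m + c))
    (trans (options-∷-≤ d (c ∷ []) (m + c) Q 0<d (≤-trans d≤c (m≤n+m c m)))
      (cong₂ _∷_ (cong Q (+-∸-assoc m d≤c))
        (trans (options-∷-≤ c [] (m + c) Q 0<c (m≤n+m c m))
          (cong (λ n → Q n ∷ []) (m+n∸n≡m m c))))))

  pile-periodic : ∀ p → (∀ n → n < c → Q (n + p) ≡ᵍ Q n) → ∀ n → Q (n + p) ≡ᵍ Q n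
  pile-periodic p window = <-rec (λ n → Q (n + p) ≡ᵍ Q n) step
    where
    open ≡ᵍ-Reasoning

    above-window : ∀ m → (∀ {n} → n < m + c → Q (n + p) ≡ᵍ Q n) → Q ((m + c) + p) ≡ᵍ Q (m + c)
    above-window m IH = begin
      Q ((m + c) + p)                        ≡⟨ cong Q (xy∙z≈xz∙y m c p) ⟩
      Q ((m + p) + c)                        ≡⟨ pile-two-moves (m + p) ⟩
      ⟪ Q ((m + p) + (c ∸ d)) , Q (m + p) ⟫  ≡⟨ cong (λ n → ⟪ Q n , Q (m + p) ⟫) (xy∙z≈xz∙y m p (c ∸ d)) ⟩
      ⟪ Q ((m + (c ∸ d)) + p) , Q (m + p) ⟫  ≈⟨ ⟪,⟫-cong (IH m+[c∸d]<m+c) (IH (m<m+n m 0<c)) ⟩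
      ⟪ Q (m + (c ∸ d)) , Q m ⟫              ≡⟨ pile-two-moves m ⟨
      Q (m + c)                              ∎
      where
      m+[c∸d]<m+c : m + (c ∸ d) < m + c
      m+[c∸d]<m+c = +-monoʳ-< m (∸-monoʳ-< 0<d d≤c)

    step : ∀ n → (∀ {n'} → n' < n → Q (n' + p) ≡ᵍ Q n') → Q (n + p) ≡ᵍ Q n
    step n IH with n <? c
    ... | yes n<c = window n n<c
    ... | no  n≮c with n ∸ c | m∸n+n≡m (≮⇒≥ n≮c)
    ...   | m | refl = above-window m IH

cycle : ℕ → Pos
cycle 0 = *L
cycle 1 = *R
cycle 2 = ⟪ *L ⟫
cycle 3 = ⟪ *R ⟫
cycle (suc (suc (suc (suc n)))) = cycle n

cycle-4*+ : ∀ ℓ r → cycle (4 * ℓ + r) ≡ cycle r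
cycle-4*+ zero    r = refl
cycle-4*+ (suc ℓ) r = trans (cong (λ n → cycle (n + r)) (*-suc 4 ℓ)) (cycle-4*+ ℓ r)

⟪⟪*L⟫⟫≡ᵍ*L : ⟪ ⟪ *L ⟫ ⟫ ≡ᵍ *L
⟪⟪*L⟫⟫≡ᵍ*L = ≡ᵍ-terminal-by-reversal (⟪ ⟪ *L ⟫ ⟫) *L-terminal
  (λ { (option _) → option fzero })
  (λ { *L-terminal → refl ; *R-terminal → refl })

⟪⟪*R⟫⟫≡ᵍ*R : ⟪ ⟪ *R ⟫ ⟫ ≡ᵍ *R
⟪⟪*R⟫⟫≡ᵍ*R = ≡ᵍ-terminal-by-reversal (⟪ ⟪ *R ⟫ ⟫) *R-terminal
  (λ { (option _) → option fzero })
  (λ { *L-terminal → refl ; *R-terminal → refl })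

⟪⟪*L,*R⟫,⟪*L⟫⟫≡ᵍ*L : ⟪ ⟪ *L , *R ⟫ , ⟪ *L ⟫ ⟫ ≡ᵍ *L
⟪⟪*L,*R⟫,⟪*L⟫⟫≡ᵍ*L = ≡ᵍ-terminal-by-reversal (⟪ ⟪ *L , *R ⟫ , ⟪ *L ⟫ ⟫) *L-terminal
  (λ { (option fzero) → option fzero
     ; (option (fsuc fzero)) → option fzero
     ; (option (fsuc (fsuc ()))) })
  (λ { *L-terminal → refl ; *R-terminal → refl })

⟪⟪*R,⟪*L⟫⟫,⟪*R⟫⟫≡ᵍ*R : ⟪ ⟪ *R , ⟪ *L ⟫ ⟫ , ⟪ *R ⟫ ⟫ ≡ᵍ *R
⟪⟪*R,⟪*L⟫⟫,⟪*R⟫⟫≡ᵍ*R = ≡ᵍ-terminal-by-reversal (⟪ ⟪ *R , ⟪ *L ⟫ ⟫ , ⟪ *R ⟫ ⟫) *R-terminal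
  (λ { (option fzero) → option fzero
     ; (option (fsuc fzero)) → option fzero
     ; (option (fsuc (fsuc ()))) })
  (λ { *L-terminal → refl ; *R-terminal → refl })

⟪⟪*R⟫,⟪*L,*R⟫⟫≡ᵍ*R : ⟪ ⟪ *R ⟫ , ⟪ *L , *R ⟫ ⟫ ≡ᵍ *R
⟪⟪*R⟫,⟪*L,*R⟫⟫≡ᵍ*R = ≡ᵍ-terminal-by-reversal (⟪ ⟪ *R ⟫ , ⟪ *L , *R ⟫ ⟫) *R-terminal
  (λ { (option fzero) → option fzero
     ; (option (fsuc fzero)) → option (fsuc fzero)
     ; (option (fsuc (fsuc ()))) })
  (λ { *L-terminal → refl ; *R-terminal → refl })

⟪*L,⟪*R,⟪*L⟫⟫⟫≡ᵍ⟪*L⟫ : ⟪ *L , ⟪ *R , ⟪ *L ⟫ ⟫ ⟫ ≡ᵍ ⟪ *L ⟫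
⟪*L,⟪*R,⟪*L⟫⟫⟫≡ᵍ⟪*L⟫ = ⟪,⟫-reversible {K = ⟪ *R , ⟪ *L ⟫ ⟫} (option (fsuc fzero))

cycle-step : ∀ n → cycle (2 + n) ≡ᵍ ⟪ cycle n ⟫
cycle-step 0 = ≡ᵍ-refl {⟪ *L ⟫}
cycle-step 1 = ≡ᵍ-refl {⟪ *R ⟫}
cycle-step 2 = ≡ᵍ-sym {⟪ ⟪ *L ⟫ ⟫} {*L} ⟪⟪*L⟫⟫≡ᵍ*L
cycle-step 3 = ≡ᵍ-sym {⟪ ⟪ *R ⟫ ⟫} {*R} ⟪⟪*R⟫⟫≡ᵍ*R
cycle-step (suc (suc (suc (suc n)))) = cycle-step n

n+[4k+5]≡[2+n]+[4k+3] : ∀ n k → n + (4 * k + 5) ≡ (2 + n) + (4 * k + 3)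
n+[4k+5]≡[2+n]+[4k+3] = solve-∀

[2+n]+[4k+1]≡n+[4k+3] : ∀ n k → (2 + n) + (4 * k + 1) ≡ n + (4 * k + 3)
[2+n]+[4k+1]≡n+[4k+3] = solve-∀

module S₄-Pile (k : ℕ) where

  c : ℕ
  c = 4 * k + 3

  open TwoMoveGame 2 c (s≤s z≤n) (≤-trans (n≤1+n 2) (m≤n+m 3 (4 * k))) public
  open ≡ᵍ-Reasoning

  4*ℓ+r<c : ∀ {ℓ r} → ℓ ≤ k → r < 3 → 4 * ℓ + r < c
  4*ℓ+r<c ℓ≤k r<3 = +-mono-≤-< (*-monoʳ-≤ 4 ℓ≤k) r<3

  r<c : ∀ {r} → r < 3 → r < c
  r<c = 4*ℓ+r<c z≤n

  pile-cycle : ∀ n → n < c → Q n ≡ᵍ cycle n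
  pile-cycle 0 _ = ≡⇒≡ᵍ (pile-no-move (s≤s z≤n))
  pile-cycle 1 _ = ≡⇒≡ᵍ (pile-no-move (s≤s (s≤s z≤n)))
  pile-cycle (suc (suc n)) 2+n<c = begin
    Q (2 + n)        ≈⟨ pile-one-move n 2+n<c ⟩
    ⟪ Q n ⟫          ≈⟨ ⟪⟫-cong (pile-cycle n (m+n≤o⇒n≤o 2 2+n<c)) ⟩
    ⟪ cycle n ⟫      ≈⟨ cycle-step n ⟨
    cycle (2 + n)    ∎

  pile-residue : ∀ ℓ r → 4 * ℓ + r < c → Q (4 * ℓ + r) ≡ᵍ cycle r
  pile-residue ℓ r bound = begin
    Q (4 * ℓ + r)      ≈⟨ pile-cycle (4 * ℓ + r) bound ⟩
    cycle (4 * ℓ + r)  ≡⟨ cycle-4*+ ℓ r ⟩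
    cycle r            ∎

  pile-4ℓ+r : ∀ {ℓ r} → ℓ ≤ k → r < 3 → Q (4 * ℓ + r) ≡ᵍ cycle r
  pile-4ℓ+r {ℓ} {r} ℓ≤k r<3 = pile-residue ℓ r (4*ℓ+r<c ℓ≤k r<3)

  pile-4ℓ+3 : ∀ {ℓ} → ℓ < k → Q (4 * ℓ + 3) ≡ᵍ ⟪ *R ⟫
  pile-4ℓ+3 {ℓ} ℓ<k = pile-residue ℓ 3 (+-monoˡ-< 3 (*-monoʳ-< 4 ℓ<k))

  pile-4ℓ : ∀ {ℓ} → ℓ ≤ k → Q (4 * ℓ) ≡ᵍ *L
  pile-4ℓ {ℓ} ℓ≤k = begin
    Q (4 * ℓ)      ≡⟨ cong Q (+-identityʳ (4 * ℓ)) ⟨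
    Q (4 * ℓ + 0)  ≈⟨ pile-4ℓ+r ℓ≤k (s≤s z≤n) ⟩
    *L             ∎

  pile-m+c : ∀ m → Q (m + c) ≡ ⟪ Q (m + (4 * k + 1)) , Q m ⟫
  pile-m+c m = trans (pile-two-moves m)
    (cong (λ e → ⟪ Q (m + e) , Q m ⟫) (+-∸-assoc (4 * k) (s≤s (s≤s z≤n))))

  pile-c : Q c ≡ᵍ ⟪ *L , *R ⟫
  pile-c = begin
    Q c                            ≡⟨ pile-m+c 0 ⟩
    ⟪ Q (4 * k + 1) , Q 0 ⟫        ≈⟨ ⟪,⟫-cong (pile-4ℓ+r ≤-refl (s≤s (s≤s z≤n))) (pile-cycle 0 (r<c (s≤s z≤n))) ⟩
    ⟪ *R , *L ⟫                    ≈⟨ ⟪,⟫-comm *R *L ⟩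
    ⟪ *L , *R ⟫                    ∎

  pile-4k+4 : Q (4 * k + 4) ≡ᵍ ⟪ *R , ⟪ *L ⟫ ⟫
  pile-4k+4 = begin
    Q (4 * k + 4)                  ≡⟨ cong Q (+-suc (4 * k) 3) ⟩
    Q (1 + c)                      ≡⟨ pile-m+c 1 ⟩
    ⟪ Q (1 + (4 * k + 1)) , Q 1 ⟫  ≡⟨ cong (λ n → ⟪ Q n , Q 1 ⟫) (+-suc (4 * k) 1) ⟨
    ⟪ Q (4 * k + 2) , Q 1 ⟫        ≈⟨ ⟪,⟫-cong (pile-4ℓ+r ≤-refl ≤-refl) (pile-cycle 1 (r<c (s≤s (s≤s z≤n)))) ⟩
    ⟪ ⟪ *L ⟫ , *R ⟫                ≈⟨ ⟪,⟫-comm ⟪ *L ⟫ *R ⟩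
    ⟪ *R , ⟪ *L ⟫ ⟫                ∎

  pile-n+[4k+5] : ∀ n → Q (n + (4 * k + 5)) ≡ ⟪ Q (n + c) , Q (2 + n) ⟫
  pile-n+[4k+5] n = trans (cong Q (n+[4k+5]≡[2+n]+[4k+3] n k))
    (trans (pile-m+c (2 + n)) (cong (λ m → ⟪ Q m , Q (2 + n) ⟫) ([2+n]+[4k+1]≡n+[4k+3] n k)))

  pile-+4-absorbed : ∀ m → 2 + m < c → ⟪ Q m , Q (4 + m) ⟫ ≡ᵍ ⟪ Q m ⟫
  pile-+4-absorbed m 2+m<c with m≤n⇒m<n∨m≡n (s≤s 2+m<c)
  ... | inj₂ 4+m≡1+c = begin
    ⟪ Q m , Q (4 + m) ⟫            ≡⟨ cong (λ n → ⟪ Q m , Q n ⟫) 4+m≡4k+4 ⟩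
    ⟪ Q m , Q (4 * k + 4) ⟫        ≈⟨ ⟪,⟫-cong Qm≡*L pile-4k+4 ⟩
    ⟪ *L , ⟪ *R , ⟪ *L ⟫ ⟫ ⟫        ≈⟨ ⟪*L,⟪*R,⟪*L⟫⟫⟫≡ᵍ⟪*L⟫ ⟩
    ⟪ *L ⟫                         ≈⟨ ⟪⟫-cong Qm≡*L ⟨
    ⟪ Q m ⟫                        ∎
    where
    4+m≡4k+4 : 4 + m ≡ 4 * k + 4
    4+m≡4k+4 = trans 4+m≡1+c (sym (+-suc (4 * k) 3))
    Qm≡*L : Q m ≡ᵍ *L
    Qm≡*L = begin
      Q m                ≈⟨ pile-cycle m (m+n≤o⇒n≤o 2 2+m<c) ⟩
      cycle (4 + m)      ≡⟨ cong cycle 4+m≡4k+4 ⟩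
      cycle (4 * k + 4)  ≡⟨ cycle-4*+ k 4 ⟩
      *L                 ∎
  ... | inj₁ (s≤s 4+m≤c) with m≤n⇒m<n∨m≡n 4+m≤c
  ...   | inj₂ 4+m≡c = begin
    ⟪ Q m , Q (4 + m) ⟫            ≡⟨ cong (λ n → ⟪ Q m , Q n ⟫) 4+m≡c ⟩
    ⟪ Q m , Q c ⟫                  ≈⟨ ⟪,⟫-cong Qm≡⟪*R⟫ pile-c ⟩
    ⟪ ⟪ *R ⟫ , ⟪ *L , *R ⟫ ⟫        ≈⟨ ⟪⟪*R⟫,⟪*L,*R⟫⟫≡ᵍ*R ⟩
    *R                             ≈⟨ ⟪⟪*R⟫⟫≡ᵍ*R ⟨
    ⟪ ⟪ *R ⟫ ⟫                      ≈⟨ ⟪⟫-cong Qm≡⟪*R⟫ ⟨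
    ⟪ Q m ⟫                        ∎
    where
    Qm≡⟪*R⟫ : Q m ≡ᵍ ⟪ *R ⟫
    Qm≡⟪*R⟫ = begin
      Q m                ≈⟨ pile-cycle m (m+n≤o⇒n≤o 2 2+m<c) ⟩
      cycle (4 + m)      ≡⟨ cong cycle 4+m≡c ⟩
      cycle (4 * k + 3)  ≡⟨ cycle-4*+ k 3 ⟩
      ⟪ *R ⟫             ∎
  ...   | inj₁ 4+m<c = ⟪,⟫-absorb (begin
    Q (4 + m)      ≈⟨ pile-cycle (4 + m) 4+m<c ⟩
    cycle m        ≈⟨ pile-cycle m (m+n≤o⇒n≤o 2 2+m<c) ⟨
    Q m            ∎)

  periodic-below-c : 1 ≤ k → ∀ n → n < c → Q (n + (4 * k + 5)) ≡ᵍ Q n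
  periodic-below-c 1≤k 0 _ = begin
    Q (0 + (4 * k + 5))            ≡⟨ pile-n+[4k+5] 0 ⟩
    ⟪ Q c , Q 2 ⟫                  ≈⟨ ⟪,⟫-cong pile-c (pile-cycle 2 (r<c ≤-refl)) ⟩
    ⟪ ⟪ *L , *R ⟫ , ⟪ *L ⟫ ⟫        ≈⟨ ⟪⟪*L,*R⟫,⟪*L⟫⟫≡ᵍ*L ⟩
    *L                             ≈⟨ pile-cycle 0 (r<c (s≤s z≤n)) ⟨
    Q 0                            ∎
  periodic-below-c 1≤k 1 _ = begin
    Q (1 + (4 * k + 5))            ≡⟨ pile-n+[4k+5] 1 ⟩
    ⟪ Q (1 + c) , Q 3 ⟫            ≡⟨ cong (λ n → ⟪ Q n , Q 3 ⟫) (+-suc (4 * k) 3) ⟨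
    ⟪ Q (4 * k + 4) , Q 3 ⟫        ≈⟨ ⟪,⟫-cong pile-4k+4 (pile-4ℓ+3 1≤k) ⟩
    ⟪ ⟪ *R , ⟪ *L ⟫ ⟫ , ⟪ *R ⟫ ⟫    ≈⟨ ⟪⟪*R,⟪*L⟫⟫,⟪*R⟫⟫≡ᵍ*R ⟩
    *R                             ≈⟨ pile-cycle 1 (r<c (s≤s (s≤s z≤n))) ⟨
    Q 1                            ∎
  periodic-below-c 1≤k (suc (suc m)) 2+m<c = begin
    Q ((2 + m) + (4 * k + 5))            ≡⟨ pile-n+[4k+5] (2 + m) ⟩
    ⟪ Q ((2 + m) + c) , Q (4 + m) ⟫      ≡⟨ cong (λ n → ⟪ Q n , Q (4 + m) ⟫) (n+[4k+5]≡[2+n]+[4k+3] m k) ⟨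
    ⟪ Q (m + (4 * k + 5)) , Q (4 + m) ⟫  ≈⟨ ⟪,⟫-cong (periodic-below-c 1≤k m m<c) (≡ᵍ-refl {Q (4 + m)}) ⟩
    ⟪ Q m , Q (4 + m) ⟫                  ≈⟨ pile-+4-absorbed m 2+m<c ⟩
    ⟪ Q m ⟫                              ≈⟨ pile-one-move m 2+m<c ⟨
    Q (2 + m)                            ∎
    where
    m<c : m < c
    m<c = m+n≤o⇒n≤o 2 2+m<c

corollary4p4 : (k : ℕ) → 1 ≤ k →
    ((n : ℕ) → pile (S₄ k) (n + (4 * k + 5)) ≡ᵍ pile (S₄ k) n)
    × ((ℓ : ℕ) → ℓ < k →
         (pile (S₄ k) (4 * ℓ) ≡ᵍ *L)
         × (pile (S₄ k) (4 * ℓ + 1) ≡ᵍ *R)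
         × (pile (S₄ k) (4 * ℓ + 2) ≡ᵍ ⟪ *L ⟫)
         × (pile (S₄ k) (4 * ℓ + 3) ≡ᵍ ⟪ *R ⟫))
    × (pile (S₄ k) (4 * k) ≡ᵍ *L)
    × (pile (S₄ k) (4 * k + 1) ≡ᵍ *R)
    × (pile (S₄ k) (4 * k + 2) ≡ᵍ ⟪ *L ⟫)
    × (pile (S₄ k) (4 * k + 3) ≡ᵍ ⟪ *L , *R ⟫)
    × (pile (S₄ k) (4 * k + 4) ≡ᵍ ⟪ *R , ⟪ *L ⟫ ⟫)
corollary4p4 k 1≤k =
  pile-periodic (4 * k + 5) (periodic-below-c 1≤k)
  ,, (λ ℓ ℓ<k → pile-4ℓ (<⇒≤ ℓ<k) ,, pile-4ℓ+r (<⇒≤ ℓ<k) 1<3 ,, pile-4ℓ+r (<⇒≤ ℓ<k) 2<3 ,, pile-4ℓ+3 ℓ<k)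
  ,, pile-4ℓ ≤-refl ,, pile-4ℓ+r ≤-refl 1<3 ,, pile-4ℓ+r ≤-refl 2<3 ,, pile-c ,, pile-4k+4
  where
  open S₄-Pile k
  1<3 : 1 < 3
  1<3 = s≤s (s≤s z≤n)
  2<3 : 2 < 3
  2<3 = ≤-refl
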